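{- Consider the sliding window heavy-hitter algorithm described in the context, run with threshold $\eta\in(0,1)$ and accuracy $\nu\in(0,\frac14)$, and let $f$ be the frequency vector induced by the active window. For each $i\in[n]$, if $f_i\le\frac{\eta}{8}\|f\|_2$, then the algorithm does not report $i$.
   Context: Stream $u_1,\ldots,u_m\in[n]$, window parameter $W$; the active window is the last $W$ updates. Subroutines: (i) $\textsc{FreqEst}$: a structure that, for any suffix of the stream, returns $F$ with $F\le\|g\|_2\le\frac{17}{16}F$ where $g$ is the frequency vector of that suffix; (ii) $\textsc{CountSketch}$ with threshold $\tau$ on a stream with frequency vector $g$: returns a list containing every $i$ with $g_i\ge\tau\|g\|_2$ and no $i$ with $g_i\le\frac{\tau}{2}\|g\|_2$; (iii) $\textsc{Counter}$ for item $i$ started at time $a$: deterministically gives a $(1+\frac{\nu}{4})$-approximation to the frequency of $i$ between time $a$ and any later time. Algorithm: run $\textsc{FreqEst}$ on the stream and keep a set $\mathcal{T}$ of timestamps. At each time $t$: add $t$ to $\mathcal{T}$ and start $\textsc{CountSketch}_t$ with threshold $\frac{\nu\eta}{32}$ on the updates from time $t$ on; let $X_a$ be the $\textsc{FreqEst}$ estimate of the $L_2$ norm from time $a$ to $t$; while there are $b<c\in\mathcal{T}$ with $c<t-W+1$, or $a<b<c\in\mathcal{T}$ with $X_a\le\frac{17}{16}X_c$, delete $b$ and $\textsc{CountSketch}_b$. Let $H_a$ be the items reported by $\textsc{CountSketch}_a$, and $F$ the $\textsc{FreqEst}$ estimate for the active window. For each $a\in\mathcal{T}$ and $i\in H_a$,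 maintain a $\textsc{Counter}$ for $i$ started at time $a$, let $\widehat{f_i}$ be an underestimate (from $\textsc{Counter}$) of the frequency of $i$ in the last $W$ updates, and report $i$ with estimate $\widehat{f_i}$ if $\widehat{f_i}\ge\frac{\eta}{2}F$.
   Formalization: The threshold η, the accuracy ν, the FreqEst estimate F and the Counter estimates $\widehat{f_i}$ take values in the rationals. -}

module Defs where

open import Data.Nat using (ℕ; zero; suc; _+_; _∸_; _^_)
open import Data.Fin using (Fin; _≟_)
open import Data.List using (List; map; allFin)
open import Data.Nat.ListAction using (sum)
open import Data.List.Membership.Propositional using (_∈_)
open import Data.Integer using (+_)
open import Data.Rational using (ℚ; _/_; _*_; _≤_; 0ℚ; 1ℚ; ½)
open import Data.Product using (_×_; Σ; ∃-syntax)
open import Data.Sum using (_⊎_)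
open import Relation.Nullary using (¬_; yes; no)

-- A stream is u : ℕ → Fin n; the updates are u 1, u 2, ..., u t at current time t.

cnt : ∀ {n} → (ℕ → Fin n) → Fin n → ℕ → ℕ → ℕ
cnt u i a zero = 0
cnt u i a (suc l) with u a ≟ i
... | yes _ = suc (cnt u i (suc a) l)
... | no _  = cnt u i (suc a) l

freqSeg : ∀ {n} → (ℕ → Fin n) → ℕ → ℕ → Fin n → ℕ
freqSeg u a b i = cnt u i a (suc b ∸ a)

normSq : ∀ {n} → (ℕ → Fin n) → ℕ → ℕ → ℕ
normSq {n} u a b = sum (map (λ j → freqSeg u a b j ^ 2) (allFin n))

winStart : ℕ → ℕ → ℕ
winStart W t = (t ∸ W) + 1

winFreq : ∀ {n} → (ℕ → Fin n) → ℕ → ℕ → Fin n → ℕ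
winFreq u W t = freqSeg u (winStart W t) t

winNormSq : ∀ {n} → (ℕ → Fin n) → ℕ → ℕ → ℕ
winNormSq u W t = normSq u (winStart W t) t

toℚ : ℕ → ℚ
toℚ k = + k / 1

-- Comparisons with c · sqrt(N), for a scalar c ≥ 0 and N = ‖g‖₂² (so sqrt(N) = ‖g‖₂):
-- "q ≤ c · ‖g‖₂"
LeScaledNorm : ℚ → ℚ → ℕ → Set
LeScaledNorm q c N = q ≤ 0ℚ ⊎ q * q ≤ (c * c) * toℚ N

-- "c · ‖g‖₂ ≤ q"
ScaledNormLe : ℚ → ℕ → ℚ → Set
ScaledNormLe c N q = 0ℚ ≤ q × (c * c) * toℚ N ≤ q * q

-- FreqEst guarantee for the active window: F ≤ ‖f‖₂ ≤ (17/16) F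
FreqEstSpec : ∀ {n} → (ℕ → Fin n) → ℕ → ℕ → ℚ → Set
FreqEstSpec u W t F =
  LeScaledNorm F 1ℚ (winNormSq u W t) × ScaledNormLe 1ℚ (winNormSq u W t) ((+ 17 / 16) * F)

tau : ℚ → ℚ → ℚ
tau ν η = (ν * η) * (+ 1 / 32)

-- CountSketch_a guarantee at time t, for the stream g of updates at times a..t:
-- every i with g_i ≥ τ ‖g‖₂ is reported, and no i with g_i ≤ (τ/2) ‖g‖₂ is reported.
CountSketchSpec : ∀ {n} → (ℕ → Fin n) → ℚ → ℕ → ℕ → List (Fin n) → Set
CountSketchSpec u τ a t Ha =
  (∀ i → ScaledNormLe τ (normSq u a t) (toℚ (freqSeg u a t i)) → i ∈ Ha) ×
  (∀ i → LeScaledNorm (toℚ (freqSeg u a t i)) (τ * ½) (normSq u a t) → ¬ (i ∈ Ha))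

Reported : ∀ {n} → List ℕ → (ℕ → List (Fin n)) → (Fin n → ℚ) → ℚ → ℚ → Fin n → Set
Reported T H fhat η F i = ∃[ a ] (a ∈ T × i ∈ H a × (η * ½) * F ≤ fhat i)

{-# OPTIONS --safe #-}
module Submission where

open import Defs
open import Data.Nat using (ℕ; _≤_)
open import Data.Fin using (Fin)
open import Data.List using (List)
open import Data.List.Membership.Propositional using (_∈_)
open import Data.Integer using (+_)
open import Data.Rational using (ℚ; _/_; _*_; _<_; 0ℚ; 1ℚ) renaming (_≤_ to _≤ℚ_)
open import Data.Product using (_×_)
open import Relation.Nullary using (¬_)

import Data.Nat as ℕ
import Data.Nat.Properties as ℕ
open import Data.Nat.ListAction using (sum)
open import Data.List using (_∷_)
open import Data.List.Relation.Unary.Any using (here; there)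
open import Data.List.Membership.Propositional.Properties using (∈-map⁺; ∈-allFin)
open import Data.Fin using (_≟_)
open import Data.Rational using (positive; nonNegative; ½)
import Data.Rational.Properties as ℚ
open import Data.Rational.Solver using (module +-*-Solver)
open import Data.Product using (_,_)
open import Data.Sum using (inj₁; inj₂)
open import Data.Empty using (⊥-elim)
open import Relation.Nullary using (yes; no)
open import Relation.Nullary.Decidable using (toWitness)
open import Relation.Binary.PropositionalEquality
  using (_≡_; refl; sym; cong; subst)

-- Reporting requires (η/2)F ≤ f̂ᵢ ≤ fᵢ, while fᵢ ≤ (η/8)‖f‖₂ ≤ (η/8)(17/16)F = (17/64)(η/2)F.
-- As the window is non-empty, ‖f‖₂ > 0, hence F > 0, and these bounds are incompatible.

cnt-self-pos : ∀ {n} (u : ℕ → Fin n) {a s} len →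
               a ≤ s → s ℕ.< a ℕ.+ len → 1 ≤ cnt u (u s) a len
cnt-self-pos u {a} {s} ℕ.zero a≤s s<a+0 =
  ⊥-elim (ℕ.<-irrefl refl (ℕ.≤-<-trans a≤s (subst (s ℕ.<_) (ℕ.+-identityʳ a) s<a+0)))
cnt-self-pos u {a} {s} (ℕ.suc len) a≤s s<a+len with u a ≟ u s
... | yes _   = ℕ.s≤s ℕ.z≤n
... | no ua≢us = cnt-self-pos u len
      (ℕ.≤∧≢⇒< a≤s (λ a≡s → ua≢us (cong u a≡s)))
      (subst (s ℕ.<_) (ℕ.+-suc a len) s<a+len)

freqSeg-last-pos : ∀ {n} (u : ℕ → Fin n) {a t} → a ≤ t → 1 ≤ freqSeg u a t (u t)
freqSeg-last-pos u {a} {t} a≤t = cnt-self-pos u (ℕ.suc t ℕ.∸ a) a≤t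
  (subst (t ℕ.<_) (sym (ℕ.m+[n∸m]≡n (ℕ.m≤n⇒m≤1+n a≤t))) (ℕ.n<1+n t))

∈⇒≤sum : ∀ {m ms} → m ∈ ms → m ≤ sum ms
∈⇒≤sum {ms = m ∷ ms} (here refl) = ℕ.m≤m+n m (sum ms)
∈⇒≤sum {ms = m ∷ ms} (there p)   = ℕ.≤-trans (∈⇒≤sum p) (ℕ.m≤n+m (sum ms) m)

normSq-pos : ∀ {n} (u : ℕ → Fin n) {a t} → a ≤ t → 1 ≤ normSq u a t
normSq-pos u {a} {t} a≤t = ℕ.≤-trans
  (ℕ.m^n>0 (freqSeg u a t (u t)) {{ℕ.>-nonZero (freqSeg-last-pos u a≤t)}} 2)
  (∈⇒≤sum (∈-map⁺ (λ j → freqSeg u a t j ℕ.^ 2) (∈-allFin (u t))))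

winStart≤ : ∀ {W t} → 1 ≤ W → 1 ≤ t → winStart W t ≤ t
winStart≤ {ℕ.suc W} {ℕ.suc t} _ _ =
  subst (t ℕ.∸ W ℕ.+ 1 ≤_) (ℕ.+-comm t 1) (ℕ.+-monoˡ-≤ 1 (ℕ.m∸n≤m t W))

winNormSq-pos : ∀ {n} (u : ℕ → Fin n) {W t} → 1 ≤ W → 1 ≤ t → 1 ≤ winNormSq u W t
winNormSq-pos u 1≤W 1≤t = normSq-pos u (winStart≤ 1≤W 1≤t)

*-self-≤⇒≤ : ∀ {p q} → 0ℚ ≤ℚ q → p * p ≤ℚ q * q → p ≤ℚ q
*-self-≤⇒≤ {p} {q} 0≤q pp≤qq = ℚ.≮⇒≥ λ q<p → ℚ.<-irrefl refl (ℚ.<-≤-trans (qq<pp q<p) pp≤qq)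
  where
  qq<pp : q < p → q * q < p * p
  qq<pp q<p = ℚ.≤-<-trans
    (ℚ.*-monoˡ-≤-nonNeg q {{nonNegative 0≤q}} (ℚ.<⇒≤ q<p))
    (ℚ.*-monoˡ-<-pos p {{positive (ℚ.≤-<-trans 0≤q q<p)}} q<p)

*-self-pos⇒pos : ∀ {q} → 0ℚ ≤ℚ q → 0ℚ < q * q → 0ℚ < q
*-self-pos⇒pos {q} 0≤q 0<qq = ℚ.≰⇒> λ q≤0 →
  ℚ.<-irrefl (sym (cong (λ r → r * r) (ℚ.≤-antisym q≤0 0≤q))) 0<qq

toℚ-pos : ∀ {N} → 1 ≤ N → 0ℚ < toℚ N
toℚ-pos {N} 1≤N = ℚ.positive⁻¹ (toℚ N) {{ℚ.normalize-pos N 1 {{_}} {{ℕ.>-nonZero 1≤N}}}}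

ScaledNormLe-one-pos : ∀ {N G} → 1 ≤ N → ScaledNormLe 1ℚ N G → 0ℚ < G
ScaledNormLe-one-pos {N} 1≤N (0≤G , N≤GG) = *-self-pos⇒pos 0≤G
  (ℚ.<-≤-trans (subst (0ℚ <_) (sym (ℚ.*-identityˡ (toℚ N))) (toℚ-pos 1≤N)) N≤GG)

LeScaledNorm⇒≤ : ∀ {q c N G} → 0ℚ ≤ℚ c → ScaledNormLe 1ℚ N G → LeScaledNorm q c N → q ≤ℚ c * G
LeScaledNorm⇒≤ {c = c} {G = G} 0≤c (0≤G , _) (inj₁ q≤0) =
  ℚ.≤-trans q≤0 (ℚ.nonNegative⁻¹ (c * G) {{ℚ.nonNeg*nonNeg⇒nonNeg c {{nonNegative 0≤c}} G {{nonNegative 0≤G}}}})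
LeScaledNorm⇒≤ {q} {c} {N} {G} 0≤c (0≤G , N≤GG) (inj₂ qq≤ccN) =
  *-self-≤⇒≤ (ℚ.nonNegative⁻¹ (c * G) {{cG≥0}}) (begin
    q * q              ≤⟨ qq≤ccN ⟩
    (c * c) * toℚ N    ≤⟨ ℚ.*-monoˡ-≤-nonNeg (c * c) {{cc≥0}} N≤GG′ ⟩
    (c * c) * (G * G)  ≡⟨ square-of-product c G ⟩
    (c * G) * (c * G)  ∎)
  where
  open ℚ.≤-Reasoning
  instance
    cc≥0 = ℚ.nonNeg*nonNeg⇒nonNeg c {{nonNegative 0≤c}} c {{nonNegative 0≤c}}
    cG≥0 = ℚ.nonNeg*nonNeg⇒nonNeg c {{nonNegative 0≤c}} G {{nonNegative 0≤G}}
  N≤GG′ : toℚ N ≤ℚ G * G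
  N≤GG′ = subst (_≤ℚ G * G) (ℚ.*-identityˡ (toℚ N)) N≤GG
  square-of-product : ∀ a b → (a * a) * (b * b) ≡ (a * b) * (a * b)
  square-of-product = +-*-Solver.solve 2 (λ a b → (a :* a) :* (b :* b) := (a :* b) :* (a :* b)) refl
    where open +-*-Solver

*-<1-shrinks : ∀ {k x} → k < 1ℚ → 0ℚ < x → k * x < x
*-<1-shrinks {k} {x} k<1 0<x =
  subst (k * x <_) (ℚ.*-identityˡ x) (ℚ.*-monoˡ-<-pos x {{positive 0<x}} k<1)

lemma3p1 : ∀ {n : ℕ} (u : ℕ → Fin n) (W t : ℕ) → 1 ≤ W → 1 ≤ t
    → (η ν : ℚ) → 0ℚ < η → η < 1ℚ → 0ℚ < ν → ν < + 1 / 4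
    → (T : List ℕ) → (∀ a → a ∈ T → 1 ≤ a × a ≤ t)
    → (H : ℕ → List (Fin n)) → (∀ a → a ∈ T → CountSketchSpec u (tau ν η) a t (H a))
    → (F : ℚ) → FreqEstSpec u W t F
    → (fhat : Fin n → ℚ) → (∀ i → fhat i ≤ℚ toℚ (winFreq u W t i))
    → (i : Fin n) → LeScaledNorm (toℚ (winFreq u W t i)) (η * (+ 1 / 8)) (winNormSq u W t)
    → ¬ Reported T H fhat η F i
lemma3p1 u W t 1≤W 1≤t η ν 0<η _ _ _ T _ H _ F (_ , ‖f‖≤G) fhat fhat≤f i fᵢ-small
         (_ , _ , _ , reported) =
  ℚ.<-irrefl refl (ℚ.<-≤-trans (*-<1-shrinks 17/64<1 0<x) x≤cx)
  where
  open ℚ.≤-Reasoning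
  G = (+ 17 / 16) * F
  x = (η * ½) * F
  0<F : 0ℚ < F
  0<F = ℚ.*-cancelˡ-<-nonNeg (+ 17 / 16)
    (subst (_< G) (sym (ℚ.*-zeroʳ (+ 17 / 16)))
      (ScaledNormLe-one-pos (winNormSq-pos u 1≤W 1≤t) ‖f‖≤G))
  instance
    η>0 = positive 0<η
    F>0 = positive 0<F
  0<x : 0ℚ < x
  0<x = ℚ.positive⁻¹ x {{ℚ.pos*pos⇒pos (η * ½) {{ℚ.pos*pos⇒pos η ½}} F}}
  17/64<1 : + 17 / 64 < 1ℚ
  17/64<1 = toWitness {a? = + 17 / 64 ℚ.<? 1ℚ} _
  0≤η/8 : 0ℚ ≤ℚ η * (+ 1 / 8)
  0≤η/8 = ℚ.<⇒≤ (ℚ.positive⁻¹ (η * (+ 1 / 8)) {{ℚ.pos*pos⇒pos η (+ 1 / 8)}})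
  x≤cx : x ≤ℚ (+ 17 / 64) * x
  x≤cx = begin
    x                            ≤⟨ reported ⟩
    fhat i                       ≤⟨ fhat≤f i ⟩
    toℚ (winFreq u W t i)        ≤⟨ LeScaledNorm⇒≤ {N = winNormSq u W t} 0≤η/8 ‖f‖≤G fᵢ-small ⟩
    (η * (+ 1 / 8)) * G          ≡⟨ rescale η F ⟩
    (+ 17 / 64) * x              ∎
    where
    rescale : ∀ a b → (a * (+ 1 / 8)) * ((+ 17 / 16) * b) ≡ (+ 17 / 64) * ((a * ½) * b)
    rescale = +-*-Solver.solve 2
      (λ a b → (a :* con (+ 1 / 8)) :* (con (+ 17 / 16) :* b) := con (+ 17 / 64) :* ((a :* con ½) :* b))
      refl
      where open +-*-Solver
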